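{- Let $q$ be a power of an odd prime, let $\lambda\in\mathbb{F}_q$ be a non-square, and let $f\in\mathbb{F}_q[X]$ be a permutation polynomial of $\mathbb{F}_q$. In the digraph $\mathcal{G}(\lambda,f)$, every vertex lies in a directed cycle and every edge lies in a directed cycle. In particular, every (weakly) connected component of $\mathcal{G}(\lambda,f)$ is strongly connected.
   Context: For a polynomial $f\in\mathbb{F}_q[X]$ and a non-square $\lambda\in\mathbb{F}_q$, $\mathcal{G}(\lambda,f)$ is the directed graph whose vertex set is $\mathbb{F}_q$, with an edge from $x$ to $y$ if and only if $(y^2-f(x))(\lambda y^2-f(x))=0$; loops are allowed. -}

module Defs where

open import Level using (Level; 0ℓ) renaming (suc to lsuc)
open import Data.Nat using (ℕ; zero; suc; _^_)
open import Data.Nat.Primality using (Prime)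
open import Data.Fin using (Fin; zero; suc; inject₁; fromℕ)
open import Data.List using (List; []; _∷_)
open import Data.Product using (Σ; ∃; ∃₂; _×_; _,_)
open import Data.Sum using (_⊎_)
open import Relation.Nullary using (¬_)
open import Relation.Binary.PropositionalEquality using (_≡_; _≢_)
open import Relation.Binary.Construct.Closure.ReflexiveTransitive using (Star)
open import Algebra.Core using (Op₁; Op₂)
open import Algebra.Structures using (IsCommutativeRing)
open import Function.Bundles using (_↔_)
open import Function.Definitions using (Injective; Bijective)

OddPrimePower : ℕ → Set
OddPrimePower q = ∃₂ λ p k → Prime p × p ≢ 2 × q ≡ p ^ suc k

record FiniteField (q : ℕ) : Set₁ where
  infixl 7 _*_
  infixl 6 _+_
  field
    Carrier           : Set
    _+_ _*_           : Op₂ Carrier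
    -_                : Op₁ Carrier
    0# 1#             : Carrier
    isCommutativeRing : IsCommutativeRing _≡_ _+_ _*_ -_ 0# 1#
    0≢1               : 0# ≢ 1#
    inverse           : ∀ x → x ≢ 0# → ∃ λ y → x * y ≡ 1#
    enumeration       : Fin q ↔ Carrier

module _ {q : ℕ} (F : FiniteField q) where
  open FiniteField F

  -- polynomials over F as coefficient lists, constant term first
  Poly : Set
  Poly = List Carrier

  eval : Poly → Carrier → Carrier
  eval []       x = 0#
  eval (c ∷ cs) x = c + x * eval cs x

  IsPermutationPolynomial : Poly → Set
  IsPermutationPolynomial f = Bijective _≡_ _≡_ (eval f)

  IsSquare : Carrier → Set
  IsSquare a = ∃ λ y → y * y ≡ a

  Edge : Carrier → Poly → Carrier → Carrier → Set
  Edge lam f x y = ((y * y) + - eval f x) * ((lam * (y * y)) + - eval f x) ≡ 0#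

-- Directed cycles in a digraph with edge relation E:
-- distinct vertices v 0, ..., v len with edges v i → v (i+1) and v len → v 0
-- (len = 0 gives a loop).
record DirectedCycle {V : Set} (E : V → V → Set) : Set where
  field
    len       : ℕ
    vertex    : Fin (suc len) → V
    distinct  : Injective _≡_ _≡_ vertex
    step      : ∀ (i : Fin len) → E (vertex (inject₁ i)) (vertex (suc i))
    close     : E (vertex (fromℕ len)) (vertex zero)

module _ {V : Set} {E : V → V → Set} where
  open DirectedCycle

  VertexOnCycle : DirectedCycle E → V → Set
  VertexOnCycle C x = ∃ λ i → vertex C i ≡ x

  EdgeOnCycle : DirectedCycle E → V → V → Set
  EdgeOnCycle C x y =
    (∃ λ (i : Fin (len C)) → vertex C (inject₁ i) ≡ x × vertex C (suc i) ≡ y)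
    ⊎ (vertex C (fromℕ (len C)) ≡ x × vertex C zero ≡ y)

EveryVertexOnCycle : {V : Set} → (V → V → Set) → Set
EveryVertexOnCycle {V} E = ∀ (x : V) → Σ (DirectedCycle E) λ C → VertexOnCycle C x

EveryEdgeOnCycle : {V : Set} → (V → V → Set) → Set
EveryEdgeOnCycle {V} E = ∀ (x y : V) → E x y → Σ (DirectedCycle E) λ C → EdgeOnCycle C x y

Undirected : {V : Set} → (V → V → Set) → V → V → Set
Undirected E x y = E x y ⊎ E y x

WeaklyConnected : {V : Set} → (V → V → Set) → V → V → Set
WeaklyConnected E = Star (Undirected E)

ComponentsStronglyConnected : {V : Set} → (V → V → Set) → Set
ComponentsStronglyConnected {V} E =
  ∀ (x y : V) → WeaklyConnected E x y → Star E x y × Star E y x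

-- There is an edge x → y iff f(x) ∈ {y², λy²}, so a vertex y ≠ 0 has exactly the in-edges
-- labelled (y, s), s ∈ Bool, coming from f⁻¹(y²) and f⁻¹(λy²), and 0 only the in-edge from
-- r = f⁻¹(0). Step back from the edge labelled (y, s) to the in-edge of its tail that is
-- selected by a sign telling y from −y, reading an edge out of 0 as leaving r through r → 0.
-- This is injective on labels with nonzero head: equal images have tails with equal f-values,
-- so the heads are ±y with the same s because λ is a non-square, and the sign fixes y. An
-- injection of a finite set is a permutation, so stepping back returns to the starting edge,
-- tracing a walk from the head of every edge back to its tail; loop erasure makes it a cycle.
module Submission where

open import Defs
open import Data.Nat using (ℕ)
open import Data.Product using (_×_)
open import Relation.Nullary using (¬_)

open import Data.Nat as ℕ using (zero; suc)
import Data.Nat.Properties as ℕ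
open import Data.Nat.GeneralisedArithmetic using (fold)
open import Data.Fin as Fin using (Fin; zero; suc; inject₁; fromℕ; toℕ)
open import Data.Fin.Properties as Fin using (pigeonhole; inj⇒≟; 2↔Bool; *↔×)
open import Data.Bool using (Bool; true; false)
open import Data.Product using (Σ; ∃; _,_; proj₁; proj₂)
open import Data.Product.Function.NonDependent.Propositional using (_×-↔_)
open import Data.Sum using (_⊎_; inj₁; inj₂)
open import Data.Empty using (⊥-elim)
open import Data.Unit using (⊤; tt)
open import Data.Maybe using (nothing)
open import Relation.Nullary using (Dec; yes; no; does)
open import Relation.Nullary.Decidable using (dec-true; dec-false)
open import Relation.Binary.Definitions using (DecidableEquality)
open import Relation.Binary.PropositionalEquality
open import Relation.Binary.Construct.Closure.ReflexiveTransitive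
  using (Star; ε; _◅_; _◅◅_; concat; reverse)
  renaming (map to mapStar; return to singleton)
open import Function.Bundles using (_↣_; Injection)
open import Function.Properties.Inverse using (↔-sym; ↔-trans; ↔⇒↣)
open import Algebra.Bundles using (CommutativeRing)
open import Tactic.RingSolver.Core.AlmostCommutativeRing using (fromCommutativeRing)

module _ {A : Set} {Q : A → Set} {P : A → A} (P-preserves : ∀ a → Q a → Q (P a)) where

  fold-preserves : ∀ k {a} → Q a → Q (fold a P k)
  fold-preserves zero    qa = qa
  fold-preserves (suc k) qa = P-preserves _ (fold-preserves k qa)

  module _ (P-injective : ∀ a b → Q a → Q b → P a ≡ P b → a ≡ b) where

    fold-cancel : ∀ m d {a} → Q a → fold a P m ≡ fold a P (m ℕ.+ d) → a ≡ fold a P d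
    fold-cancel zero    d qa eq = eq
    fold-cancel (suc m) d qa eq =
      fold-cancel m d qa (P-injective _ _ (fold-preserves m qa) (fold-preserves (m ℕ.+ d) qa) eq)

    fold-periodic : ∀ {n} → A ↣ Fin n → ∀ {a} → Q a → ∃ λ k → fold a P (suc k) ≡ a
    fold-periodic {n} encode {a} qa
      with i , j , i<j , eq ← pigeonhole (ℕ.n<1+n n) (λ k → Injection.to encode (fold a P (toℕ k)))
      with d , i+1+d≡j ← ℕ.m≤n⇒∃[o]m+o≡n i<j
      = d , sym (fold-cancel (toℕ i) (suc d) qa (begin
          fold a P (toℕ i)               ≡⟨ Injection.injective encode eq ⟩
          fold a P (toℕ j)               ≡⟨ cong (fold a P) (sym i+1+d≡j) ⟩
          fold a P (suc (toℕ i ℕ.+ d))   ≡⟨ cong (fold a P) (sym (ℕ.+-suc (toℕ i) d)) ⟩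
          fold a P (toℕ i ℕ.+ suc d)     ∎))
      where open ≡-Reasoning

module _ {A : Set} {n : ℕ} (encode : A ↣ Fin n) {σ : A → A}
         (σ-involutive : ∀ a → σ (σ a) ≡ a) where
  open Injection encode using (to; injective)

  below-σ : A → Bool
  below-σ a = does (to a Fin.≤? to (σ a))

  below-σ-sound : ∀ a → below-σ a ≡ true → to a Fin.≤ to (σ a)
  below-σ-sound a eq with to a Fin.≤? to (σ a)
  ... | yes a≤σa = a≤σa
  ... | no  a≰σa with () ← trans (sym eq) (dec-false (to a Fin.≤? to (σ a)) a≰σa)

  below-σ-σ : ∀ a → below-σ a ≡ below-σ (σ a) → a ≡ σ a
  below-σ-σ a eq with Fin.≤-total (to a) (to (σ a))
  ... | inj₁ a≤σa = injective (Fin.≤-antisym a≤σa σa≤a)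
    where
      σa≤a : to (σ a) Fin.≤ to a
      σa≤a = subst (to (σ a) Fin.≤_) (cong to (σ-involutive a))
               (below-σ-sound (σ a) (trans (sym eq) (dec-true (to a Fin.≤? to (σ a)) a≤σa)))
  ... | inj₂ σa≤a = injective (Fin.≤-antisym a≤σa σa≤a)
    where
      σa≤σσa : to (σ a) Fin.≤ to (σ (σ a))
      σa≤σσa = subst (to (σ a) Fin.≤_) (cong to (sym (σ-involutive a))) σa≤a
      a≤σa : to a Fin.≤ to (σ a)
      a≤σa = below-σ-sound a (trans eq (dec-true (to (σ a) Fin.≤? to (σ (σ a))) σa≤σσa))

module _ {V : Set} {E : V → V → Set} where

  _∈ᵥ_ : ∀ {y z} → V → Star E y z → Set
  _∈ᵥ_ {y} v ε       = v ≡ y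
  _∈ᵥ_ {y} v (_ ◅ p) = v ≡ y ⊎ v ∈ᵥ p

  Simple : ∀ {y z} → Star E y z → Set
  Simple ε           = ⊤
  Simple {y} (_ ◅ p) = ¬ (y ∈ᵥ p) × Simple p

  SimplePath : V → V → Set
  SimplePath y z = Σ (Star E y z) Simple

  suffixFrom : ∀ {y z v} (p : Star E y z) → Simple p → v ∈ᵥ p → SimplePath v z
  suffixFrom ε       _       refl        = ε , tt
  suffixFrom (e ◅ p) simple  (inj₁ refl) = e ◅ p , simple
  suffixFrom (e ◅ p) (_ , s) (inj₂ v∈p)  = suffixFrom p s v∈p

  steps : ∀ {y z} → Star E y z → ℕ
  steps ε       = 0
  steps (_ ◅ p) = suc (steps p)

  vertex : ∀ {y z} (p : Star E y z) → Fin (suc (steps p)) → V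
  vertex {y} ε       _       = y
  vertex {y} (_ ◅ p) zero    = y
  vertex     (_ ◅ p) (suc i) = vertex p i

  vertex-∈ᵥ : ∀ {y z} (p : Star E y z) i → vertex p i ∈ᵥ p
  vertex-∈ᵥ ε       zero    = refl
  vertex-∈ᵥ (_ ◅ p) zero    = inj₁ refl
  vertex-∈ᵥ (_ ◅ p) (suc i) = inj₂ (vertex-∈ᵥ p i)

  vertex-injective : ∀ {y z} (p : Star E y z) → Simple p → ∀ {i j} → vertex p i ≡ vertex p j → i ≡ j
  vertex-injective ε       _         {zero}  {zero}  _  = refl
  vertex-injective (_ ◅ p) _         {zero}  {zero}  _  = refl
  vertex-injective (_ ◅ p) (y∉p , _) {zero}  {suc j} eq = ⊥-elim (y∉p (subst (_∈ᵥ p) (sym eq) (vertex-∈ᵥ p j)))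
  vertex-injective (_ ◅ p) (y∉p , _) {suc i} {zero}  eq = ⊥-elim (y∉p (subst (_∈ᵥ p) eq (vertex-∈ᵥ p i)))
  vertex-injective (_ ◅ p) (_ , s)   {suc i} {suc j} eq = cong suc (vertex-injective p s eq)

  vertex-first : ∀ {y z} (p : Star E y z) → vertex p zero ≡ y
  vertex-first ε       = refl
  vertex-first (_ ◅ p) = refl

  vertex-last : ∀ {y z} (p : Star E y z) → vertex p (fromℕ (steps p)) ≡ z
  vertex-last ε       = refl
  vertex-last (_ ◅ p) = vertex-last p

  vertex-step : ∀ {y z} (p : Star E y z) (i : Fin (steps p)) → E (vertex p (inject₁ i)) (vertex p (suc i))
  vertex-step (e ◅ p) zero    = subst (E _) (sym (vertex-first p)) e
  vertex-step (_ ◅ p) (suc i) = vertex-step p i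

  cycleThroughEdge : ∀ {x y} → E x y → SimplePath y x → Σ (DirectedCycle E) λ C → EdgeOnCycle C x y
  cycleThroughEdge e (p , simple) =
    record { len      = steps p
           ; vertex   = vertex p
           ; distinct = vertex-injective p simple
           ; step     = vertex-step p
           ; close    = subst₂ E (sym (vertex-last p)) (sym (vertex-first p)) e }
    , inj₂ (vertex-last p , vertex-first p)

  module _ (_≟_ : DecidableEquality V) where

    _∈ᵥ?_ : ∀ {y z} v (p : Star E y z) → Dec (v ∈ᵥ p)
    _∈ᵥ?_ {y} v ε = v ≟ y
    _∈ᵥ?_ {y} v (_ ◅ p) with v ≟ y | v ∈ᵥ? p
    ... | yes v≡y | _        = yes (inj₁ v≡y)
    ... | no  _   | yes v∈p  = yes (inj₂ v∈p)
    ... | no  v≢y | no  v∉p  = no λ { (inj₁ v≡y) → v≢y v≡y ; (inj₂ v∈p) → v∉p v∈p }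

    loopErase : ∀ {y z} → Star E y z → SimplePath y z
    loopErase ε = ε , tt
    loopErase {y} (e ◅ w) with loopErase w
    ... | p , simple with y ∈ᵥ? p
    ...   | yes y∈p = suffixFrom p simple y∈p
    ...   | no  y∉p = e ◅ p , y∉p , simple

  module _ (returns : ∀ {x y} → E x y → Star E y x) where

    componentsStronglyConnected : ComponentsStronglyConnected E
    componentsStronglyConnected x y w = concat (mapStar forward w) , concat (reverse backward w)
      where
        forward : ∀ {u v} → Undirected E u v → Star E u v
        forward (inj₁ e) = singleton e
        forward (inj₂ e) = returns e

        backward : ∀ {u v} → Undirected E u v → Star E v u
        backward (inj₁ e) = returns e
        backward (inj₂ e) = singleton e

    module _ (_≟_ : DecidableEquality V) where

      everyEdgeOnCycle : EveryEdgeOnCycle E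
      everyEdgeOnCycle x y e = cycleThroughEdge e (loopErase _≟_ (returns e))

      everyVertexOnCycle : (∀ y → ∃ λ x → E x y) → EveryVertexOnCycle E
      everyVertexOnCycle incoming y with x , e ← incoming y with everyEdgeOnCycle x y e
      ... | C , inj₁ (i , _ , vertex[1+i]≡y) = C , suc i , vertex[1+i]≡y
      ... | C , inj₂ (_ , vertex[0]≡y)      = C , zero , vertex[0]≡y

module FieldProperties {q : ℕ} (F : FiniteField q) where
  open FiniteField F

  commutativeRing : CommutativeRing _ _
  commutativeRing = record { isCommutativeRing = isCommutativeRing }

  open CommutativeRing commutativeRing
    using (*-assoc; *-comm; *-identityˡ; *-identityʳ; +-identityˡ; -‿inverseʳ; zeroʳ; ring)
  open import Algebra.Properties.Ring ring using (x∙y⁻¹≈ε⇒x≈y; -‿involutive; -‿distribˡ-*)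
  open import Tactic.RingSolver.NonReflective (fromCommutativeRing commutativeRing (λ _ → nothing))
    using (solve; _⊕_; _⊗_; _⊜_)

  encodeCarrier : Carrier ↣ Fin q
  encodeCarrier = ↔⇒↣ (↔-sym enumeration)

  _≟_ : DecidableEquality Carrier
  _≟_ = inj⇒≟ encodeCarrier

  *-cancelˡ : ∀ {c x y} → c ≢ 0# → c * x ≡ c * y → x ≡ y
  *-cancelˡ {c} {x} {y} c≢0 eq with c⁻¹ , cc⁻¹≡1 ← inverse c c≢0 = begin
      x               ≡⟨ sym (*-identityˡ x) ⟩
      1# * x          ≡⟨ cong (_* x) (trans (sym cc⁻¹≡1) (*-comm c c⁻¹)) ⟩
      (c⁻¹ * c) * x   ≡⟨ *-assoc c⁻¹ c x ⟩
      c⁻¹ * (c * x)   ≡⟨ cong (c⁻¹ *_) eq ⟩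
      c⁻¹ * (c * y)   ≡⟨ sym (*-assoc c⁻¹ c y) ⟩
      (c⁻¹ * c) * y   ≡⟨ cong (_* y) (trans (*-comm c⁻¹ c) cc⁻¹≡1) ⟩
      1# * y          ≡⟨ *-identityˡ y ⟩
      y               ∎
    where open ≡-Reasoning

  x*y≡0⇒x≡0⊎y≡0 : ∀ {x y} → x * y ≡ 0# → x ≡ 0# ⊎ y ≡ 0#
  x*y≡0⇒x≡0⊎y≡0 {x} {y} eq with x ≟ 0#
  ... | yes x≡0 = inj₁ x≡0
  ... | no  x≢0 = inj₂ (*-cancelˡ x≢0 (trans eq (sym (zeroʳ x))))

  x≢0⇒x*x≢0 : ∀ {x} → x ≢ 0# → x * x ≢ 0#
  x≢0⇒x*x≢0 x≢0 eq with x*y≡0⇒x≡0⊎y≡0 eq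
  ... | inj₁ x≡0 = x≢0 x≡0
  ... | inj₂ x≡0 = x≢0 x≡0

  difference-of-squares : ∀ x y → (x + - y) * (x + y) ≡ x * x + - (y * y)
  difference-of-squares x y = begin
      (x + - y) * (x + y)                 ≡⟨ expand x (- y) y ⟩
      x * (y + - y) + (x * x + - y * y)   ≡⟨ cong₂ (λ u v → x * u + (x * x + v)) (-‿inverseʳ y) (sym (-‿distribˡ-* y y)) ⟩
      x * 0# + (x * x + - (y * y))        ≡⟨ cong (_+ (x * x + - (y * y))) (zeroʳ x) ⟩
      0# + (x * x + - (y * y))            ≡⟨ +-identityˡ _ ⟩
      x * x + - (y * y)                   ∎
    where
      open ≡-Reasoning
      -- −y enters as a variable w: the solver cannot compare the coefficients that ⊝ produces.
      expand : ∀ x w y → (x + w) * (x + y) ≡ x * (y + w) + (x * x + w * y)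
      expand = solve 3 (λ x w y → ((x ⊕ w) ⊗ (x ⊕ y)) ⊜ ((x ⊗ (y ⊕ w)) ⊕ ((x ⊗ x) ⊕ (w ⊗ y)))) refl

  x*x≡y*y⇒x≡y⊎x≡-y : ∀ {x y} → x * x ≡ y * y → x ≡ y ⊎ x ≡ - y
  x*x≡y*y⇒x≡y⊎x≡-y {x} {y} eq with x*y≡0⇒x≡0⊎y≡0 [x-y][x+y]≡0
    where
      [x-y][x+y]≡0 : (x + - y) * (x + y) ≡ 0#
      [x-y][x+y]≡0 = trans (difference-of-squares x y) (trans (cong (_+ - (y * y)) eq) (-‿inverseʳ (y * y)))
  ... | inj₁ x-y≡0 = inj₁ (x∙y⁻¹≈ε⇒x≈y x y x-y≡0)
  ... | inj₂ x+y≡0 = inj₂ (x∙y⁻¹≈ε⇒x≈y x (- y) (trans (cong (x +_) (-‿involutive y)) x+y≡0))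

  x*x≡c*[y*y]⇒IsSquare[c] : ∀ {c x y} → y ≢ 0# → x * x ≡ c * (y * y) → IsSquare F c
  x*x≡c*[y*y]⇒IsSquare[c] {c} {x} {y} y≢0 eq with y⁻¹ , yy⁻¹≡1 ← inverse y y≢0 = x * y⁻¹ , (begin
      (x * y⁻¹) * (x * y⁻¹)       ≡⟨ square-* x y⁻¹ ⟩
      (x * x) * (y⁻¹ * y⁻¹)       ≡⟨ cong (_* (y⁻¹ * y⁻¹)) eq ⟩
      (c * (y * y)) * (y⁻¹ * y⁻¹) ≡⟨ *-assoc c _ _ ⟩
      c * ((y * y) * (y⁻¹ * y⁻¹)) ≡⟨ cong (c *_) (sym (square-* y y⁻¹)) ⟩
      c * ((y * y⁻¹) * (y * y⁻¹)) ≡⟨ cong (λ u → c * (u * u)) yy⁻¹≡1 ⟩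
      c * (1# * 1#)               ≡⟨ cong (c *_) (*-identityˡ 1#) ⟩
      c * 1#                      ≡⟨ *-identityʳ c ⟩
      c                           ∎)
    where
      open ≡-Reasoning
      square-* : ∀ x y → (x * y) * (x * y) ≡ (x * x) * (y * y)
      square-* = solve 2 (λ x y → ((x ⊗ y) ⊗ (x ⊗ y)) ⊜ ((x ⊗ x) ⊗ (y ⊗ y))) refl

  sign : Carrier → Bool
  sign = below-σ encodeCarrier { -_ } -‿involutive

  sign-neg : ∀ x → sign x ≡ sign (- x) → x ≡ - x
  sign-neg = below-σ-σ encodeCarrier { -_ } -‿involutive

module WalkBack {q : ℕ} (F : FiniteField q) (lam : FiniteField.Carrier F) (lam-nonsquare : ¬ IsSquare F lam)
                (f : Poly F) (f-bijective : IsPermutationPolynomial F f) where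
  open FiniteField F
  open FieldProperties F
  open CommutativeRing commutativeRing using (-‿inverseʳ; zeroˡ; zeroʳ; ring)
  open import Algebra.Properties.Ring ring using (x∙y⁻¹≈ε⇒x≈y)

  G : Carrier → Carrier → Set
  G = Edge F lam f

  f-injective : ∀ {x y} → eval F f x ≡ eval F f y → x ≡ y
  f-injective = proj₁ f-bijective

  f⁻¹ : Carrier → Carrier
  f⁻¹ c = proj₁ (proj₂ f-bijective c)

  f[f⁻¹] : ∀ c → eval F f (f⁻¹ c) ≡ c
  f[f⁻¹] c = proj₂ (proj₂ f-bijective c) refl

  scaledSquare : Bool → Carrier → Carrier
  scaledSquare true  y = y * y
  scaledSquare false y = lam * (y * y)

  scaledSquare-zero : ∀ s → scaledSquare s 0# ≡ 0#
  scaledSquare-zero true  = zeroˡ 0#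
  scaledSquare-zero false = trans (cong (lam *_) (zeroˡ 0#)) (zeroʳ lam)

  lam≢0 : lam ≢ 0#
  lam≢0 lam≡0 = lam-nonsquare (0# , trans (zeroˡ 0#) (sym lam≡0))

  scaledSquare≢0 : ∀ s {y} → y ≢ 0# → scaledSquare s y ≢ 0#
  scaledSquare≢0 true  y≢0 = x≢0⇒x*x≢0 y≢0
  scaledSquare≢0 false y≢0 eq with x*y≡0⇒x≡0⊎y≡0 eq
  ... | inj₁ lam≡0 = lam≢0 lam≡0
  ... | inj₂ y*y≡0 = x≢0⇒x*x≢0 y≢0 y*y≡0

  scaledSquare-injective : ∀ {s s' y y'} → y ≢ 0# → y' ≢ 0# → scaledSquare s y ≡ scaledSquare s' y'
                         → s ≡ s' × (y ≡ y' ⊎ y ≡ - y')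
  scaledSquare-injective {true}  {true}  _   _    eq = refl , x*x≡y*y⇒x≡y⊎x≡-y eq
  scaledSquare-injective {false} {false} _   _    eq = refl , x*x≡y*y⇒x≡y⊎x≡-y (*-cancelˡ lam≢0 eq)
  scaledSquare-injective {true}  {false} _   y'≢0 eq = ⊥-elim (lam-nonsquare (x*x≡c*[y*y]⇒IsSquare[c] y'≢0 eq))
  scaledSquare-injective {false} {true}  y≢0 _    eq = ⊥-elim (lam-nonsquare (x*x≡c*[y*y]⇒IsSquare[c] y≢0 (sym eq)))

  edge-intro : ∀ {x y} s → eval F f x ≡ scaledSquare s y → G x y
  edge-intro {x} {y} true  fx≡y² rewrite fx≡y² =
    trans (cong (_* (lam * (y * y) + - (y * y))) (-‿inverseʳ (y * y))) (zeroˡ _)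
  edge-intro {x} {y} false fx≡λy² rewrite fx≡λy² =
    trans (cong ((y * y + - (lam * (y * y))) *_) (-‿inverseʳ (lam * (y * y)))) (zeroʳ _)

  edge-elim : ∀ {x y} → G x y → ∃ λ s → eval F f x ≡ scaledSquare s y
  edge-elim e with x*y≡0⇒x≡0⊎y≡0 e
  ... | inj₁ y²-fx≡0  = true  , sym (x∙y⁻¹≈ε⇒x≈y _ _ y²-fx≡0)
  ... | inj₂ λy²-fx≡0 = false , sym (x∙y⁻¹≈ε⇒x≈y _ _ λy²-fx≡0)

  Label : Set
  Label = Carrier × Bool

  head : Label → Carrier
  head = proj₁

  tail : Label → Carrier
  tail (y , s) = f⁻¹ (scaledSquare s y)

  NonzeroHead : Label → Set
  NonzeroHead l = head l ≢ 0#

  source≡tail : ∀ {x y} → G x y → ∃ λ s → x ≡ tail (y , s)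
  source≡tail e with s , fx≡ ← edge-elim e = s , f-injective (trans fx≡ (sym (f[f⁻¹] _)))

  tail-edge : ∀ l → G (tail l) (head l)
  tail-edge (y , s) = edge-intro s (f[f⁻¹] (scaledSquare s y))

  incoming : ∀ y → ∃ λ x → G x y
  incoming y = tail (y , true) , tail-edge (y , true)

  root : Carrier
  root = f⁻¹ 0#

  root-edge : G root 0#
  root-edge = edge-intro true (trans (f[f⁻¹] 0#) (sym (scaledSquare-zero true)))

  tail≢root : ∀ l → NonzeroHead l → tail l ≢ root
  tail≢root (y , s) y≢0 eq =
    scaledSquare≢0 s y≢0 (trans (sym (f[f⁻¹] _)) (trans (cong (eval F f) eq) (f[f⁻¹] 0#)))

  bypassZero : Carrier → Carrier
  bypassZero x with x ≟ 0#
  ... | yes _ = root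
  ... | no  _ = x

  bypassZero-reaches : ∀ x → Star G (bypassZero x) x
  bypassZero-reaches x with x ≟ 0#
  ... | yes refl = root-edge ◅ ε
  ... | no  _    = ε

  bypassZero≢0 : ∀ {x} → x ≢ root → bypassZero x ≢ 0#
  bypassZero≢0 {x} x≢root with x ≟ 0#
  ... | yes refl = λ root≡0 → x≢root (sym root≡0)
  ... | no  x≢0  = x≢0

  bypassZero-injective : ∀ {x x'} → x ≢ root → x' ≢ root → bypassZero x ≡ bypassZero x' → x ≡ x'
  bypassZero-injective {x} {x'} x≢root x'≢root eq with x ≟ 0# | x' ≟ 0#
  ... | yes x≡0 | yes x'≡0 = trans x≡0 (sym x'≡0)
  ... | yes _   | no  _    = ⊥-elim (x'≢root (sym eq))
  ... | no  _   | yes _    = ⊥-elim (x≢root eq)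
  ... | no  _   | no  _    = eq

  bypassZero≡root⇒≡0 : ∀ {x} → x ≢ root → bypassZero x ≡ root → x ≡ 0#
  bypassZero≡root⇒≡0 {x} x≢root eq with x ≟ 0#
  ... | yes x≡0 = x≡0
  ... | no  _   = ⊥-elim (x≢root eq)

  back : Label → Label
  back l = bypassZero (tail l) , sign (head l)

  back-nonzero : ∀ l → NonzeroHead l → NonzeroHead (back l)
  back-nonzero l l≢0 = bypassZero≢0 (tail≢root l l≢0)

  back-injective : ∀ l l' → NonzeroHead l → NonzeroHead l' → back l ≡ back l' → l ≡ l'
  back-injective (y , s) (y' , s') y≢0 y'≢0 eq =
    same-label (scaledSquare-injective y≢0 y'≢0 same-value)
    where
      same-tail : tail (y , s) ≡ tail (y' , s')
      same-tail = bypassZero-injective (tail≢root (y , s) y≢0) (tail≢root (y' , s') y'≢0) (cong proj₁ eq)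
      same-value : scaledSquare s y ≡ scaledSquare s' y'
      same-value = trans (sym (f[f⁻¹] _)) (trans (cong (eval F f) same-tail) (f[f⁻¹] _))
      same-label : s ≡ s' × (y ≡ y' ⊎ y ≡ - y') → (y , s) ≡ (y' , s')
      same-label (s≡s' , inj₁ y≡y')  = cong₂ _,_ y≡y' s≡s'
      same-label (s≡s' , inj₂ y≡-y') = cong₂ _,_ (trans y≡-y' (sym (sign-neg y' sign[y']≡sign[-y']))) s≡s'
        where
          sign[y']≡sign[-y'] : sign y' ≡ sign (- y')
          sign[y']≡sign[-y'] = sym (trans (cong sign (sym y≡-y')) (cong proj₂ eq))

  encodeLabel : Label ↣ Fin (q ℕ.* 2)
  encodeLabel = ↔⇒↣ (↔-trans (↔-sym enumeration ×-↔ ↔-sym 2↔Bool) (↔-sym *↔×))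

  back-periodic : ∀ {l} → NonzeroHead l → ∃ λ k → fold l back (suc k) ≡ l
  back-periodic = fold-periodic {Q = NonzeroHead} back-nonzero back-injective encodeLabel

  back-reaches : ∀ l → Star G (head (back l)) (head l)
  back-reaches l = bypassZero-reaches (tail l) ◅◅ tail-edge l ◅ ε

  reaches-back : ∀ {l} → NonzeroHead l → Star G (head l) (head (back l))
  reaches-back {l} l≢0 with k , back¹⁺ᵏ[l]≡l ← back-periodic l≢0 =
    subst (λ l' → Star G (head l') (head (back l))) back¹⁺ᵏ[l]≡l (orbit k)
    where
      orbit : ∀ n → Star G (head (fold l back (suc n))) (head (back l))
      orbit zero    = ε
      orbit (suc n) = back-reaches (fold l back (suc n)) ◅◅ orbit n

  head-reaches-tail : ∀ {l} → NonzeroHead l → Star G (head l) (tail l)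
  head-reaches-tail {l} l≢0 = reaches-back {l} l≢0 ◅◅ bypassZero-reaches (tail l)

  zero-reaches-root : Star G 0# root
  zero-reaches-root with root ≟ 0#
  ... | yes root≡0 = subst (Star G 0#) (sym root≡0) ε
  ... | no  root≢0 with k , back[j]≡r ← back-periodic {root , true} root≢0 =
    subst (λ x → G x (head j)) tail[j]≡0 (tail-edge j)
      ◅ subst (Star G (head j)) (cong proj₁ back[j]≡r) (reaches-back {j} j≢0)
    where
      j : Label
      j = fold (root , true) back k
      j≢0 : NonzeroHead j
      j≢0 = fold-preserves {Q = NonzeroHead} back-nonzero k root≢0
      tail[j]≡0 : tail j ≡ 0#
      tail[j]≡0 = bypassZero≡root⇒≡0 (tail≢root j j≢0) (cong proj₁ back[j]≡r)

  returns : ∀ {x y} → G x y → Star G y x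
  returns {y = y} e with s , refl ← source≡tail e | y ≟ 0#
  ... | yes refl = subst (Star G 0#) (cong f⁻¹ (sym (scaledSquare-zero s))) zero-reaches-root
  ... | no  y≢0  = head-reaches-tail {y , s} y≢0

proposition2p2 : (q : ℕ) → OddPrimePower q → (F : FiniteField q)
    → (lam : FiniteField.Carrier F) → ¬ IsSquare F lam
    → (f : Poly F) → IsPermutationPolynomial F f
    → EveryVertexOnCycle (Edge F lam f)
      × EveryEdgeOnCycle (Edge F lam f)
      × ComponentsStronglyConnected (Edge F lam f)
proposition2p2 q _ F lam lam-nonsquare f f-bijective =
  everyVertexOnCycle returns _≟_ incoming , everyEdgeOnCycle returns _≟_ , componentsStronglyConnected returns
  where
    open FieldProperties F using (_≟_)
    open WalkBack F lam lam-nonsquare f f-bijective using (returns; incoming)
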